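{- Let $p$ be a positive integer, let $\lambda$ be a partition all of whose parts are multiples of $p$, and let $\lambda^c$ be the conjugate partition of $\lambda$. Then every maximal run of consecutive integers contained in the $\beta$-set $\beta(\lambda^c)$ has length divisible by $p$.
   Context: For a partition $\mu$, its $\beta$-set $\beta(\mu)$ is the set of hook lengths of the boxes in the first column of the Young diagram of $\mu$, where the hook length of a box $B$ is the number of boxes consisting of $B$ itself, the boxes directly to its right and the boxes directly below it. A maximal run of consecutive integers in a set $S\subseteq\mathbb{Z}$ is a set $\{a,a+1,\dots,b\}\subseteq S$ with $a-1\notin S$ and $b+1\notin S$; its length is $b-a+1$. -}

module Defs where

open import Data.Nat using (ℕ; zero; suc; _+_; _∸_; _<_; _≤_; _>_; _≥_)
open import Data.Nat.Properties using (_<?_; _≤?_)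
open import Data.List using (List; []; _∷_; length; filter; drop; map; upTo; lookup)
open import Data.List.Relation.Unary.All using (All)
open import Data.List.Relation.Unary.Linked using (Linked)
open import Data.Product using (Σ; _×_; ∃; _,_)
open import Data.Fin using (Fin; toℕ)
open import Relation.Binary.PropositionalEquality using (_≡_)
open import Relation.Nullary using (¬_)

IsPartition : List ℕ → Set
IsPartition μ = Linked _≥_ μ × All (λ x → 0 < x) μ

head₀ : List ℕ → ℕ
head₀ []      = 0
head₀ (x ∷ _) = x

part : List ℕ → ℕ → ℕ
part []      _       = 0
part (x ∷ _) zero    = x
part (_ ∷ μ) (suc i) = part μ i

-- conjugate partition: its j-th part (j = 1 … μ₁) is #{ i : μᵢ ≥ j }
conjugate : List ℕ → List ℕ
conjugate μ = map (λ j → length (filter (λ x → suc j ≤? x) μ)) (upTo (head₀ μ))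

-- hook length of the box in row i, column j (both 0-indexed) of the
-- Young diagram of μ: the box itself, the boxes to its right in row i
-- (μᵢ - j - 1 of them) and the boxes below it in column j
-- (rows i' > i with μ_{i'} > j).
hookLength : List ℕ → ℕ → ℕ → ℕ
hookLength μ i j = suc ((part μ i ∸ suc j) + length (filter (λ x → j <? x) (drop (suc i) μ)))

-- β-set: hook lengths of the boxes in the first column (column 0),
-- one box for each row i < length μ.
_∈β_ : ℕ → List ℕ → Set
x ∈β μ = Σ ℕ λ i → i < length μ × hookLength μ i 0 ≡ x

MaximalRun : (ℕ → Set) → ℕ → ℕ → Set
MaximalRun S a b =
  a ≤ b
  × (∀ n → a ≤ n → n ≤ b → S n)
  × (∀ m → suc m ≡ a → ¬ S m)
  × ¬ S (suc b)

-- Write ν = λᶜ, L = ℓ(ν) = λ₁ and hᵢ for the hook length of the box in row i,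
-- column 0 of ν, so that β(ν) = { hᵢ : i < L }.  The proof has two halves.
--
-- (1) Sequences.  Suppose h is strictly decreasing on [0, L), p ∣ L, and
--     hᵢ = h_{i+1} + 1 whenever p ∤ i + 1.  Then the values of a maximal run
--     {a, …, b} of the image are taken at consecutive indices k, …, i; the
--     maximality at a forces p ∣ i + 1 and the maximality at b forces p ∣ k,
--     so p divides (i + 1) − k = b + 1 − a.
--
-- (2) Partitions.  Consecutive first-column hooks satisfy
--     hᵢ = (νᵢ − ν_{i+1}) + 1 + h_{i+1}, and the column lengths of λ can only
--     drop at multiples of p because every part of λ is a multiple of p.
--     Hence the first-column hooks of ν satisfy the hypotheses of (1).
module Submission where

open import Defs
open import Data.Nat using (ℕ; zero; suc; _+_; _∸_; _≤_; _<_; z≤n; s≤s; s≤s⁻¹)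
open import Data.Nat.Properties
  using ( _≤?_; _<?_; ≤-refl; ≤-trans; ≤-antisym; <-trans; ≤-<-trans; <-≤-trans; <-irrefl
        ; <-asym; <-cmp; n<1+n; n≤1+n; m≤n⇒m≤1+n; m≤n⇒m<n∨m≡n; m≤m+n; m≤n+m
        ; +-identityʳ; +-suc; +-assoc; +-monoʳ-≤; +-∸-assoc; m+[n∸m]≡n; m∸n+n≡m
        ; n∸n≡0; 1+n≢n)
open import Data.Nat.Divisibility using (_∣_; _∣?_; _∣0; ∣m+n∣m⇒∣n)
open import Data.List using (List; []; _∷_; length; filter; upTo; applyUpTo)
open import Data.List.Properties
  using (length-map; length-upTo; map-applyUpTo; filter-accept; filter-some)
open import Data.List.Relation.Unary.All using (All; []; _∷_)
import Data.List.Relation.Unary.All as All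
open import Data.List.Relation.Unary.Any using (here)
open import Data.Product using (Σ; _×_; _,_)
open import Data.Sum using (inj₁; inj₂)
open import Relation.Binary.Definitions using (tri<; tri≈; tri>)
open import Relation.Nullary using (¬_; yes; no; contradiction)
open import Relation.Unary using (Pred; Decidable)
open import Level using (0ℓ)
open import Relation.Binary.PropositionalEquality
  using (_≡_; refl; sym; trans; cong; subst; subst₂; module ≡-Reasoning)

module DescentsAtMultiples
  (p L : ℕ) (h : ℕ → ℕ) (p∣L : p ∣ L)
  (decreasing : ∀ i → suc i < L → h (suc i) < h i)
  (unitStep : ∀ i → suc i < L → ¬ p ∣ suc i → h i ≡ suc (h (suc i)))
  where

  Image : ℕ → Set
  Image x = Σ ℕ λ i → i < L × h i ≡ x

  decreasing⁺ : ∀ {j k} → j < k → k < L → h k < h j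
  decreasing⁺ {j} {suc k} (s≤s j≤k) sk<L with m≤n⇒m<n∨m≡n j≤k
  ... | inj₂ refl = decreasing j sk<L
  ... | inj₁ j<k  = <-trans (decreasing k sk<L) (decreasing⁺ j<k (<-trans (n<1+n k) sk<L))

  adjacent : ∀ {j k} → j < L → k < L → h j ≡ suc (h k) → suc j ≡ k
  adjacent {j} {k} j<L k<L hj≡1+hk with <-cmp j k
  ... | tri≈ _ refl _ = contradiction (sym hj≡1+hk) 1+n≢n
  ... | tri> _ _ k<j  = contradiction hk<hj (<-asym (decreasing⁺ k<j j<L))
    where
    hk<hj : h k < h j
    hk<hj = subst (h k <_) (sym hj≡1+hk) (n<1+n (h k))
  ... | tri< j<k _ _ with m≤n⇒m<n∨m≡n j<k
  ...   | inj₂ sj≡k = sj≡k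
  ...   | inj₁ sj<k = contradiction (<-≤-trans (decreasing⁺ sj<k k<L) hsj≤hk) (<-irrefl refl)
    where
    hsj≤hk : h (suc j) ≤ h k
    hsj≤hk = s≤s⁻¹ (subst (h (suc j) <_) hj≡1+hk (decreasing j (<-trans sj<k k<L)))

  below : ∀ {j n i} → j + n ≡ i → i < L → j < L
  below {j} {n} refl i<L = ≤-<-trans (m≤m+n j n) i<L

  runIndices : ∀ n {i} → i < L → (∀ m → m ≤ n → Image (h i + m)) →
               Σ ℕ λ j → j + n ≡ i × h j ≡ h i + n
  runIndices zero {i} _ _ = i , +-identityʳ i , sym (+-identityʳ (h i))
  runIndices (suc n) {i} i<L inImage
    with runIndices n i<L (λ m m≤n → inImage m (m≤n⇒m≤1+n m≤n))
       | inImage (suc n) ≤-refl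
  ... | j , j+n≡i , hj≡ | k , k<L , hk≡ =
    k , trans (+-suc k n) (trans (cong (_+ n) sk≡j) j+n≡i) , hk≡
    where
    sk≡j : suc k ≡ j
    sk≡j = adjacent k<L (below j+n≡i i<L)
             (trans hk≡ (trans (+-suc (h i) n) (cong suc (sym hj≡))))

  interior : ∀ {k} → suc k ≤ L → ¬ p ∣ suc k → suc k < L
  interior sk≤L p∤sk with m≤n⇒m<n∨m≡n sk≤L
  ... | inj₁ sk<L  = sk<L
  ... | inj₂ refl = contradiction p∣L p∤sk

  lowerEnd : ∀ {i} → i < L → (∀ m → suc m ≡ h i → ¬ Image m) → p ∣ suc i
  lowerEnd {i} i<L noPredecessor with p ∣? suc i
  ... | yes p∣si = p∣si
  ... | no p∤si  = contradiction (suc i , si<L , refl)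
                     (noPredecessor (h (suc i)) (sym (unitStep i si<L p∤si)))
    where
    si<L : suc i < L
    si<L = interior i<L p∤si

  upperEnd : ∀ {k} → k < L → ¬ Image (suc (h k)) → p ∣ k
  upperEnd {zero} _ _ = p ∣0
  upperEnd {suc k} sk<L noSuccessor with p ∣? suc k
  ... | yes p∣sk = p∣sk
  ... | no p∤sk  = contradiction (k , <-trans (n<1+n k) sk<L , unitStep k sk<L p∤sk)
                     noSuccessor

  -- a maximal run {a, …, b} occupies the indices k, …, i with p ∣ k and
  -- p ∣ i + 1, so its length (i + 1) − k is a multiple of p
  maximalRun-length : ∀ a b → MaximalRun Image a b → p ∣ suc b ∸ a
  maximalRun-length a b (a≤b , inRun , noPred , noSucc) with inRun a ≤-refl a≤b
  ... | i , i<L , refl with runIndices (b ∸ h i) i<L inRunFromHi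
    where
    inRunFromHi : ∀ m → m ≤ b ∸ h i → Image (h i + m)
    inRunFromHi m m≤n = inRun (h i + m) (m≤m+n (h i) m)
      (subst (h i + m ≤_) (m+[n∸m]≡n a≤b) (+-monoʳ-≤ (h i) m≤n))
  ... | k , k+n≡i , hk≡ = subst (p ∣_) (sym (+-∸-assoc 1 a≤b)) (∣m+n∣m⇒∣n p∣k+sn p∣k)
    where
    n : ℕ
    n = b ∸ h i
    hk≡b : h k ≡ b
    hk≡b = trans hk≡ (m+[n∸m]≡n a≤b)
    p∣k : p ∣ k
    p∣k = upperEnd (below k+n≡i i<L) (subst (λ x → ¬ Image (suc x)) (sym hk≡b) noSucc)
    p∣k+sn : p ∣ k + suc n
    p∣k+sn = subst (p ∣_) (sym (trans (+-suc k n) (cong suc k+n≡i))) (lowerEnd i<L noPred)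

filter-length-mono : ∀ {A : Set} {P Q : Pred A 0ℓ} (P? : Decidable P) (Q? : Decidable Q) {xs : List A} →
                     All (λ x → P x → Q x) xs → length (filter P? xs) ≤ length (filter Q? xs)
filter-length-mono P? Q? [] = z≤n
filter-length-mono P? Q? {x ∷ xs} (P⇒Q ∷ rest) with P? x | Q? x
... | yes _  | yes _  = s≤s (filter-length-mono P? Q? rest)
... | yes px | no ¬qx = contradiction (P⇒Q px) ¬qx
... | no _   | yes _  = m≤n⇒m≤1+n (filter-length-mono P? Q? rest)
... | no _   | no _   = filter-length-mono P? Q? rest

firstColumnHook-step : ∀ ν i → 0 < part ν (suc i) → part ν (suc i) ≤ part ν i →
  hookLength ν i 0 ≡ (part ν i ∸ part ν (suc i)) + suc (hookLength ν (suc i) 0)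
firstColumnHook-step (x ∷ ν) (suc i) 0<ν₊ ν₊≤ν = firstColumnHook-step ν i 0<ν₊ ν₊≤ν
firstColumnHook-step (suc x ∷ suc y ∷ ν) zero 0<y (s≤s y≤x)
  rewrite filter-accept (λ z → 0 <? z) {xs = ν} 0<y = regroup (length (filter (λ z → 0 <? z) ν))
  where
  open ≡-Reasoning
  regroup : ∀ c → suc (x + suc c) ≡ (x ∸ y) + suc (suc (y + c))
  regroup c = begin
    suc (x + suc c)               ≡⟨ cong suc (+-suc x c) ⟩
    suc (suc (x + c))             ≡⟨ cong (λ t → suc (suc (t + c))) (sym (m∸n+n≡m y≤x)) ⟩
    suc (suc ((x ∸ y) + y + c))   ≡⟨ cong (λ t → suc (suc t)) (+-assoc (x ∸ y) y c) ⟩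
    suc (suc ((x ∸ y) + (y + c))) ≡⟨ cong suc (sym (+-suc (x ∸ y) (y + c))) ⟩
    suc ((x ∸ y) + suc (y + c))   ≡⟨ sym (+-suc (x ∸ y) (suc (y + c))) ⟩
    (x ∸ y) + suc (suc (y + c))   ∎

columnLength : List ℕ → ℕ → ℕ
columnLength μ j = length (filter (λ x → suc j ≤? x) μ)

part-applyUpTo : ∀ (f : ℕ → ℕ) {n i} → i < n → part (applyUpTo f n) i ≡ f i
part-applyUpTo f {suc n} {zero}  _         = refl
part-applyUpTo f {suc n} {suc i} (s≤s i<n) = part-applyUpTo (λ k → f (suc k)) i<n

conjugate-part : ∀ μ {j} → j < head₀ μ → part (conjugate μ) j ≡ columnLength μ j
conjugate-part μ {j} j<μ₁ =
  trans (cong (λ ν → part ν j) (map-applyUpTo (λ k → k) (columnLength μ) (head₀ μ)))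
        (part-applyUpTo (columnLength μ) j<μ₁)

conjugate-length : ∀ μ → length (conjugate μ) ≡ head₀ μ
conjugate-length μ = trans (length-map (columnLength μ) (upTo (head₀ μ))) (length-upTo (head₀ μ))

columnLength-positive : ∀ μ {j} → j < head₀ μ → 0 < columnLength μ j
columnLength-positive (x ∷ xs) {j} j<x = filter-some (λ y → suc j ≤? y) (here j<x)

columnLength-antitone : ∀ μ j → columnLength μ (suc j) ≤ columnLength μ j
columnLength-antitone μ j =
  filter-length-mono (λ y → suc (suc j) ≤? y) (λ y → suc j ≤? y)
    (All.universal (λ x → ≤-trans (n≤1+n (suc j))) μ)

-- if every part is a multiple of p, no part equals j + 1 when p ∤ j + 1,
-- so columns j and j + 1 have the same length
columnLength-flat : ∀ {p} μ j → All (p ∣_) μ → ¬ p ∣ suc j →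
                    columnLength μ j ≡ columnLength μ (suc j)
columnLength-flat {p} μ j p∣μ p∤sj =
  ≤-antisym (filter-length-mono (λ y → suc j ≤? y) (λ y → suc (suc j) ≤? y)
               (All.map skipsSucJ p∣μ))
            (columnLength-antitone μ j)
  where
  skipsSucJ : ∀ {x} → p ∣ x → suc j ≤ x → suc (suc j) ≤ x
  skipsSucJ p∣x sj≤x with m≤n⇒m<n∨m≡n sj≤x
  ... | inj₁ sj<x = sj<x
  ... | inj₂ refl = contradiction p∣x p∤sj

conjugateHook-step : ∀ μ i → suc i < length (conjugate μ) →
  hookLength (conjugate μ) i 0
    ≡ (columnLength μ i ∸ columnLength μ (suc i)) + suc (hookLength (conjugate μ) (suc i) 0)
conjugateHook-step μ i si<L =
  subst₂ (λ cᵢ cᵢ₊ → hookLength ν i 0 ≡ (cᵢ ∸ cᵢ₊) + suc (hookLength ν (suc i) 0))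
    partᵢ part₊ (firstColumnHook-step ν i positive antitone)
  where
  ν : List ℕ
  ν = conjugate μ
  si<μ₁ : suc i < head₀ μ
  si<μ₁ = subst (suc i <_) (conjugate-length μ) si<L
  partᵢ : part ν i ≡ columnLength μ i
  partᵢ = conjugate-part μ (<-trans (n<1+n i) si<μ₁)
  part₊ : part ν (suc i) ≡ columnLength μ (suc i)
  part₊ = conjugate-part μ si<μ₁
  positive : 0 < part ν (suc i)
  positive = subst (0 <_) (sym part₊) (columnLength-positive μ si<μ₁)
  antitone : part ν (suc i) ≤ part ν i
  antitone = subst₂ _≤_ (sym part₊) (sym partᵢ) (columnLength-antitone μ i)

head₀-divisible : ∀ {p} μ → All (p ∣_) μ → p ∣ head₀ μ
head₀-divisible []       []        = _ ∣0
head₀-divisible (x ∷ xs) (p∣x ∷ _) = p∣x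

-- The first-column hooks of μᶜ decrease, and by one except at multiples of p,
-- so Part (1) applies to them.
lemma3p3 : (p : ℕ) → 0 < p → (μ : List ℕ) → IsPartition μ → All (p ∣_) μ →
    (a b : ℕ) → MaximalRun (λ x → x ∈β conjugate μ) a b → p ∣ (suc b ∸ a)
lemma3p3 p _ μ _ p∣μ = maximalRun-length
  where
  ν : List ℕ
  ν = conjugate μ
  hook : ℕ → ℕ
  hook i = hookLength ν i 0
  p∣L : p ∣ length ν
  p∣L = subst (p ∣_) (sym (conjugate-length μ)) (head₀-divisible μ p∣μ)
  decreasing : ∀ i → suc i < length ν → hook (suc i) < hook i
  decreasing i si<L = subst (hook (suc i) <_) (sym (conjugateHook-step μ i si<L)) (m≤n+m _ _)
  unitStep : ∀ i → suc i < length ν → ¬ p ∣ suc i → hook i ≡ suc (hook (suc i))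
  unitStep i si<L p∤si = trans (conjugateHook-step μ i si<L)
    (cong (_+ suc (hook (suc i)))
      (trans (cong (_∸ columnLength μ (suc i)) (columnLength-flat μ i p∣μ p∤si))
             (n∸n≡0 (columnLength μ (suc i)))))
  open DescentsAtMultiples p (length ν) hook p∣L decreasing unitStep
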